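{- Let $n\ge1$, $h\ge1$, $0\le\bar w\le n$, let $H$ be a multiset of $h$ binary strings each of length $n$ and weight $\bar w$, let $M=M(H)$, and let $f$ be a cumulative weight function that is a solution to $M$ and satisfies conditions (C1) and (C2). Then: (i) for any $m\in A(\bar w/2)$, either $f_m=f_{m^*}$, or there are exactly two maximal intervals between $f_m$ and $f_{m^*}$ and exactly one of these two intervals is contained in $[\lfloor n/2\rfloor]$; (ii) for any $m\in[2h]\setminus A(\bar w/2)$, there is exactly one maximal interval between $f_m$ and $f_{m^*}$.
   Context: Notation: $[n]=\{1,\dots,n\}$; $[n_1,n_2]=\{n_1,\dots,n_2\}$ if $n_1\le n_2$, else $\emptyset$. For a binary string $t$ of length $n$, $\mathrm{wt}(t)$ is its number of ones, $t[l]$, $t[-l]$ its length-$l$ prefix and suffix; $M(t)$ is the multiset union of $\{(j-\mathrm{wt}(t[j]),\mathrm{wt}(t[j])) : j\in[n]\}$ and $\{(j-\mathrm{wt}(t[-j]),\mathrm{wt}(t[-j])) : j\in[n]\}$, and $M(H)$ is the multiset union of $M(t)$, $t\in H$. A cumulative weight function (CWF) is $f:\{0,\dots,n\}\times[2h]\to\{0,\dots,n\}$ with (a) $f(0,m)=0$; (b) $f(l,m)-f(l-1,m)\in\{0,1\}$ for $(l,m)\in[n]\times[2h]$; (c) for each $j\in[h]$ there is $w_j$ with $f(l,2j-1)+f(n-l,2j)=w_j$ for all $l\in\{0,\dots,n\}$. Write $f_m(l)=f(l,m)$; $m^*=m-1$ if $m$ is even, $m^*=m+1$ if $m$ is odd.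 $f$ is a solution to $M$ if $M=\{(l-f_m(l),f_m(l)): m\in[2h],l\in[n]\}$ as multisets. $D(m_1,m_2)=\{l\in[n]:f_{m_1}(l)\ne f_{m_2}(l)\}$; a nonempty $[k_1,k_2]\subset[n]$ is a maximal interval between $f_{m_1}$ and $f_{m_2}$ if $[k_1,k_2]\subset D(m_1,m_2)$ and $k_1-1,k_2+1\notin D(m_1,m_2)$. Condition (C1): for any $m_1,m_2\in[2h]$ with $m_1^*=m_2$ there are at most two maximal intervals between $f_{m_1}$ and $f_{m_2}$. Condition (C2): for any $m_1,m_2\in[2h]$ with $m_1^*\ne m_2$ there is at most one maximal interval between $f_{m_1}$ and $f_{m_2}$. The median weight of $f_m$ is $\mathrm{med}(f_m)=\frac12(f_m(\lfloor n/2\rfloor)+f_m(\lceil n/2\rceil))$, and $A(w)=\{m\in[2h]:\mathrm{med}(f_m)=w\}$ for $w\in\mathbb{R}$. -}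

module Defs where

open import Data.Nat using (ℕ; zero; suc; _+_; _*_; _∸_; _≤_; _/_; _%_)
open import Data.Bool using (Bool; true; false)
open import Data.List using (List; []; _∷_; map; concatMap; upTo; take; drop; length; _++_)
open import Data.List.Relation.Unary.All using (All)
open import Data.List.Relation.Binary.Permutation.Propositional using (_↭_)
open import Data.Product using (_×_; _,_; ∃)
open import Data.Sum using (_⊎_)
open import Relation.Nullary using (¬_)
open import Relation.Binary.PropositionalEquality using (_≡_; _≢_)

-- binary strings are lists of booleans (true = 1)
-- wt t = number of ones
wt : List Bool → ℕ
wt [] = 0
wt (true ∷ t) = suc (wt t)
wt (false ∷ t) = wt t

range1 : ℕ → List ℕ
range1 n = map suc (upTo n)

prefix : ℕ → List Bool → List Bool
prefix l t = take l t

suffix : ℕ → List Bool → List Bool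
suffix l t = drop (length t ∸ l) t

pt : List Bool → ℕ → ℕ × ℕ
pt s j = (j ∸ wt s , wt s)

-- M(t), a multiset represented as a list (compared up to permutation)
Mt : List Bool → List (ℕ × ℕ)
Mt t = map (λ j → pt (prefix j t) j) (range1 (length t))
    ++ map (λ j → pt (suffix j t) j) (range1 (length t))

MH : List (List Bool) → List (ℕ × ℕ)
MH H = concatMap Mt H

-- a candidate f : {0..n} × [2h] → {0..n} is a function ℕ → ℕ → ℕ, f l m = f(l,m);
-- values outside the domain are irrelevant.
CWF : ℕ → ℕ → (ℕ → ℕ → ℕ) → Set
CWF n h f =
    (∀ l m → l ≤ n → 1 ≤ m → m ≤ 2 * h → f l m ≤ n)
  × (∀ m → 1 ≤ m → m ≤ 2 * h → f 0 m ≡ 0)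
  × (∀ l m → 1 ≤ l → l ≤ n → 1 ≤ m → m ≤ 2 * h →
        (f l m ≡ f (l ∸ 1) m) ⊎ (f l m ≡ suc (f (l ∸ 1) m)))
  × (∀ j → 1 ≤ j → j ≤ h →
        ∃ λ w → ∀ l → l ≤ n → f l (2 * j ∸ 1) + f (n ∸ l) (2 * j) ≡ w)

star : ℕ → ℕ
star m with m % 2
... | zero = m ∸ 1
... | suc _ = suc m

solList : ℕ → ℕ → (ℕ → ℕ → ℕ) → List (ℕ × ℕ)
solList n h f = concatMap (λ m → map (λ l → (l ∸ f l m , f l m)) (range1 n)) (range1 (2 * h))

IsSolution : ℕ → ℕ → (ℕ → ℕ → ℕ) → List (ℕ × ℕ) → Set
IsSolution n h f M = M ↭ solList n h f

InD : ℕ → (ℕ → ℕ → ℕ) → ℕ → ℕ → ℕ → Set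
InD n f m₁ m₂ l = 1 ≤ l × l ≤ n × f l m₁ ≢ f l m₂

MaxInterval : ℕ → (ℕ → ℕ → ℕ) → ℕ → ℕ → ℕ → ℕ → Set
MaxInterval n f m₁ m₂ k₁ k₂ =
    k₁ ≤ k₂
  × 1 ≤ k₁ × k₂ ≤ n
  × (∀ l → k₁ ≤ l → l ≤ k₂ → InD n f m₁ m₂ l)
  × ¬ InD n f m₁ m₂ (k₁ ∸ 1)
  × ¬ InD n f m₁ m₂ (suc k₂)

AtMostOneMI : ℕ → (ℕ → ℕ → ℕ) → ℕ → ℕ → Set
AtMostOneMI n f m₁ m₂ = ∀ a b c d →
  MaxInterval n f m₁ m₂ a b → MaxInterval n f m₁ m₂ c d → (a ≡ c × b ≡ d)

AtMostTwoMI : ℕ → (ℕ → ℕ → ℕ) → ℕ → ℕ → Set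
AtMostTwoMI n f m₁ m₂ = ∀ a b c d e g →
  MaxInterval n f m₁ m₂ a b → MaxInterval n f m₁ m₂ c d → MaxInterval n f m₁ m₂ e g →
  (a ≡ c × b ≡ d) ⊎ (a ≡ e × b ≡ g) ⊎ (c ≡ e × d ≡ g)

ExactlyOneMI : ℕ → (ℕ → ℕ → ℕ) → ℕ → ℕ → Set
ExactlyOneMI n f m₁ m₂ =
  (∃ λ a → ∃ λ b → MaxInterval n f m₁ m₂ a b) × AtMostOneMI n f m₁ m₂

IntervalSubset : ℕ → ℕ → ℕ → Set
IntervalSubset a b k = ∀ l → a ≤ l → l ≤ b → 1 ≤ l × l ≤ k

ExactlyTwoMIOneInLowerHalf : ℕ → (ℕ → ℕ → ℕ) → ℕ → ℕ → Set
ExactlyTwoMIOneInLowerHalf n f m₁ m₂ =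
  ∃ λ a → ∃ λ b → ∃ λ c → ∃ λ d →
      MaxInterval n f m₁ m₂ a b
    × MaxInterval n f m₁ m₂ c d
    × ¬ (a ≡ c × b ≡ d)
    × (∀ x y → MaxInterval n f m₁ m₂ x y → (x ≡ a × y ≡ b) ⊎ (x ≡ c × y ≡ d))
    × ((IntervalSubset a b (n / 2) × ¬ IntervalSubset c d (n / 2))
       ⊎ (¬ IntervalSubset a b (n / 2) × IntervalSubset c d (n / 2)))

ceilHalf : ℕ → ℕ
ceilHalf n = (suc n) / 2

-- m ∈ A(w̄/2) ⟺ med(f_m) = w̄/2 ⟺ f_m(⌊n/2⌋) + f_m(⌈n/2⌉) = w̄  (both sides doubled)
InA-half : ℕ → (ℕ → ℕ → ℕ) → ℕ → ℕ → Set
InA-half n f w̄ m = f (n / 2) m + f (ceilHalf n) m ≡ w̄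

{-# OPTIONS --safe #-}
-- For a pair (m , m*), condition (c) reads f_{m*}(l) + f_m(n - l) = w, and w = w̄ because
-- M(H) forces f_m(n) = w̄ (the full prefix of every string has weight w̄). Hence
-- f_m(l) = f_{m*}(l) iff f_m(l) + f_m(n - l) = w̄, so D(m , m*) is invariant under l ↦ n - l
-- and the reflection of a maximal interval is again one. A reflection-invariant interval
-- contains ⌊n/2⌋, and ⌊n/2⌋ ∈ D(m , m*) iff m ∉ A(w̄/2).
-- If m ∈ A(w̄/2), a maximal interval misses ⌊n/2⌋, so it and its reflection are distinct
-- intervals on opposite sides of the centre, and by (C1) there are no others.
-- If m ∉ A(w̄/2), let I₀ be the maximal interval through ⌊n/2⌋ and ⌈n/2⌉. For any maximal
-- interval J, (C1) applied to I₀, J and the reflection of J forces J to contain ⌊n/2⌋,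
-- so J = I₀.
module Submission where

open import Defs
open import Data.Nat using (ℕ; _≤_; _*_)
open import Data.Bool using (Bool)
open import Data.List using (List; length)
open import Data.List.Relation.Unary.All using (All)
open import Data.Product using (_×_)
open import Data.Sum using (_⊎_)
open import Relation.Nullary using (¬_)
open import Relation.Binary.PropositionalEquality using (_≡_)

open import Data.Nat
  using (zero; suc; _+_; _∸_; _<_; _/_; _%_; z≤n; s≤s; _≟_; _<?_; _⊓_; ⌊_/2⌋; ⌈_/2⌉)
open import Data.Nat.Properties
open import Data.Nat.DivMod using (m/n≡1+[m∸n]/n; m*n/n≡m; /-monoˡ-≤; [m+kn]%n≡m%n; m*n%n≡0)
open import Data.Bool using (true; false)
open import Data.List using ([]; _∷_; map; take; drop)
open import Data.List.Properties using (length-take; length-drop; take-all)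
open import Data.List.Relation.Unary.All as All using ()
open import Data.List.Relation.Unary.All.Properties using (map⁺; ++⁺; concat⁺)
open import Data.List.Membership.Propositional using (_∈_; lose)
open import Data.List.Membership.Propositional.Properties using (∈-map⁺; ∈-upTo⁺; ∈-concatMap⁺)
open import Data.List.Relation.Binary.Permutation.Propositional using (↭-sym)
open import Data.List.Relation.Binary.Permutation.Propositional.Properties using (∈-resp-↭)
open import Data.Product using (_,_; ∃; ∃₂; proj₁; proj₂; uncurry)
open import Data.Sum using (inj₁; inj₂)
open import Data.Empty using (⊥-elim)
open import Relation.Nullary using (Dec; yes; no)
open import Function using (_∘_)
open import Relation.Nullary.Decidable using (_×-dec_; ¬?; decidable-stable)
open import Relation.Binary.PropositionalEquality
  using (refl; sym; trans; cong; cong₂; subst; subst₂; module ≡-Reasoning)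

n/2≡⌊n/2⌋ : ∀ n → n / 2 ≡ ⌊ n /2⌋
n/2≡⌊n/2⌋ zero = refl
n/2≡⌊n/2⌋ (suc zero) = refl
n/2≡⌊n/2⌋ (suc (suc n)) = trans (m/n≡1+[m∸n]/n {suc (suc n)} (s≤s (s≤s z≤n))) (cong suc (n/2≡⌊n/2⌋ n))

⌈n/2⌉≤1+⌊n/2⌋ : ∀ n → ⌈ n /2⌉ ≤ suc ⌊ n /2⌋
⌈n/2⌉≤1+⌊n/2⌋ zero = z≤n
⌈n/2⌉≤1+⌊n/2⌋ (suc zero) = ≤-refl
⌈n/2⌉≤1+⌊n/2⌋ (suc (suc n)) = s≤s (⌈n/2⌉≤1+⌊n/2⌋ n)

module Halves (n : ℕ) where

  p q : ℕ
  p = n / 2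
  q = ceilHalf n

  p+q≡n : p + q ≡ n
  p+q≡n = trans (cong₂ _+_ (n/2≡⌊n/2⌋ n) (n/2≡⌊n/2⌋ (suc n))) (⌊n/2⌋+⌈n/2⌉≡n n)

  p≤q : p ≤ q
  p≤q = subst₂ _≤_ (sym (n/2≡⌊n/2⌋ n)) (sym (n/2≡⌊n/2⌋ (suc n))) (⌊n/2⌋≤⌈n/2⌉ n)

  q≤1+p : q ≤ suc p
  q≤1+p = subst₂ (λ a b → a ≤ suc b) (sym (n/2≡⌊n/2⌋ (suc n))) (sym (n/2≡⌊n/2⌋ n)) (⌈n/2⌉≤1+⌊n/2⌋ n)

  n∸p≡q : n ∸ p ≡ q
  n∸p≡q = trans (cong (_∸ p) (sym p+q≡n)) (m+n∸m≡n p q)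

  q≤n : q ≤ n
  q≤n = subst (q ≤_) p+q≡n (m≤n+m q p)

  p≤n : p ≤ n
  p≤n = ≤-trans p≤q q≤n

  symmetric⇒∋p : ∀ {a b} → a ≤ b → b ≤ n → a ≡ n ∸ b → a ≤ p × p ≤ b
  symmetric⇒∋p {a} {b} a≤b b≤n a≡n∸b = a≤p , p≤b
    where
    open ≤-Reasoning
    a*2≤n : a * 2 ≤ n
    a*2≤n = begin
      a * 2       ≡⟨ *-comm a 2 ⟩
      a + (a + 0) ≡⟨ cong (a +_) (+-identityʳ a) ⟩
      a + a       ≤⟨ +-monoʳ-≤ a a≤b ⟩
      a + b       ≡⟨ cong (_+ b) a≡n∸b ⟩
      n ∸ b + b   ≡⟨ m∸n+n≡m b≤n ⟩
      n           ∎
    a≤p : a ≤ p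
    a≤p = subst (_≤ p) (m*n/n≡m a 2) (/-monoˡ-≤ 2 a*2≤n)
    p≤b : p ≤ b
    p≤b = begin
      p           ≤⟨ p≤q ⟩
      q           ≡⟨ sym n∸p≡q ⟩
      n ∸ p       ≤⟨ ∸-monoʳ-≤ n a≤p ⟩
      n ∸ a       ≡⟨ cong (n ∸_) a≡n∸b ⟩
      n ∸ (n ∸ b) ≡⟨ m∸[m∸n]≡n b≤n ⟩
      b           ∎

IntervalSubset-intro : ∀ {a b k} → 1 ≤ a → b ≤ k → IntervalSubset a b k
IntervalSubset-intro 1≤a b≤k l a≤l l≤b = ≤-trans 1≤a a≤l , ≤-trans l≤b b≤k

IntervalSubset⇒≤ : ∀ {a b k} → a ≤ b → IntervalSubset a b k → b ≤ k
IntervalSubset⇒≤ a≤b sub = proj₂ (sub _ a≤b ≤-refl)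

module MaxIntervals (n : ℕ) (f : ℕ → ℕ → ℕ) (m₁ m₂ : ℕ) where

  D : ℕ → Set
  D = InD n f m₁ m₂

  MI : ℕ → ℕ → Set
  MI = MaxInterval n f m₁ m₂

  IntervalInD : ℕ → ℕ → Set
  IntervalInD a b = ∀ l → a ≤ l → l ≤ b → D l

  InD? : ∀ l → Dec (D l)
  InD? l = (1 ≤? l) ×-dec ((l ≤? n) ×-dec ¬? (f l m₁ ≟ f l m₂))

  ¬InD-0 : ¬ D 0
  ¬InD-0 (() , _)

  IntervalInD-pair : ∀ {a b} → b ≤ suc a → D a → D b → IntervalInD a b
  IntervalInD-pair b≤1+a Da Db l a≤l l≤b with m≤n⇒m<n∨m≡n a≤l
  ... | inj₂ refl = Da
  ... | inj₁ a<l = subst D (≤-antisym (≤-trans b≤1+a a<l) l≤b) Db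

  IntervalInD-consˡ : ∀ {a b} → D a → IntervalInD (suc a) b → IntervalInD a b
  IntervalInD-consˡ Da I l a≤l l≤b with m≤n⇒m<n∨m≡n a≤l
  ... | inj₂ refl = Da
  ... | inj₁ a<l = I l a<l l≤b

  IntervalInD-snocʳ : ∀ {a b} → IntervalInD a b → D (suc b) → IntervalInD a (suc b)
  IntervalInD-snocʳ I Db l a≤l l≤1+b with m≤n⇒m<n∨m≡n l≤1+b
  ... | inj₂ refl = Db
  ... | inj₁ (s≤s l≤b) = I l a≤l l≤b

  extendˡ : ∀ a {b} → IntervalInD a b → ∃ λ a′ → a′ ≤ a × IntervalInD a′ b × ¬ D (a′ ∸ 1)
  extendˡ zero I = zero , ≤-refl , I , ¬InD-0
  extendˡ (suc a) I with InD? a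
  ... | no ¬Da = suc a , ≤-refl , I , ¬Da
  ... | yes Da with extendˡ a (IntervalInD-consˡ Da I)
  ...   | a′ , a′≤a , I′ , ¬D = a′ , m≤n⇒m≤1+n a′≤a , I′ , ¬D

  extendʳ : ∀ k {a b} → n ≤ b + k → IntervalInD a b → ∃ λ b′ → b ≤ b′ × IntervalInD a b′ × ¬ D (suc b′)
  extendʳ zero {b = b} n≤b+0 I = b , ≤-refl , I , λ (_ , 1+b≤n , _) →
    <⇒≱ 1+b≤n (subst (n ≤_) (+-identityʳ b) n≤b+0)
  extendʳ (suc k) {b = b} n≤b+1+k I with InD? (suc b)
  ... | no ¬D = b , ≤-refl , I , ¬D
  ... | yes Db with extendʳ k (subst (n ≤_) (+-suc b k) n≤b+1+k) (IntervalInD-snocʳ I Db)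
  ...   | b′ , 1+b≤b′ , I′ , ¬D = b′ , ≤-trans (n≤1+n b) 1+b≤b′ , I′ , ¬D

  MaxInterval-extend : ∀ {a b} → a ≤ b → IntervalInD a b → ∃₂ λ a′ b′ → MI a′ b′ × a′ ≤ a × b ≤ b′
  MaxInterval-extend {a} {b} a≤b I with extendˡ a I
  ... | a′ , a′≤a , I′ , ¬Dˡ with extendʳ n (m≤n+m n b) I′
  ...   | b′ , b≤b′ , I″ , ¬Dʳ =
    a′ , b′ , (a′≤b′ , proj₁ (I″ a′ ≤-refl a′≤b′) , proj₁ (proj₂ (I″ b′ a′≤b′ ≤-refl)) , I″ , ¬Dˡ , ¬Dʳ) ,
    a′≤a , b≤b′
    where
    a′≤b′ : a′ ≤ b′
    a′≤b′ = ≤-trans a′≤a (≤-trans a≤b b≤b′)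

  MaxInterval-overlap⇒≡ : ∀ {a b c d} → MI a b → MI c d → c ≤ b → a ≤ d → a ≡ c × b ≡ d
  MaxInterval-overlap⇒≡ I J c≤b a≤d =
    ≤-antisym (≮⇒≥ (¬left J I a≤d)) (≮⇒≥ (¬left I J c≤b)) ,
    ≤-antisym (≮⇒≥ (¬right J I a≤d)) (≮⇒≥ (¬right I J c≤b))
    where
    ¬left : ∀ {a b c d} → MI a b → MI c d → c ≤ b → ¬ a < c
    ¬left (_ , _ , _ , I , _) (_ , _ , _ , _ , ¬Dc∸1 , _) c≤b a<c =
      ¬Dc∸1 (I _ (<⇒≤pred a<c) (≤-trans (m∸n≤m _ 1) c≤b))
    ¬right : ∀ {a b c d} → MI a b → MI c d → c ≤ b → ¬ b < d
    ¬right (_ , _ , _ , _ , _ , ¬D1+b) (_ , _ , _ , J , _) c≤b b<d =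
      ¬D1+b (J _ (≤-trans c≤b (n≤1+n _)) b<d)

  MaxInterval-avoid : ∀ {a b c} → MI a b → ¬ D c → b < c ⊎ c < a
  MaxInterval-avoid {a} {b} {c} (_ , _ , _ , I , _) ¬Dc with b <? c | c <? a
  ... | yes b<c | _ = inj₁ b<c
  ... | no _ | yes c<a = inj₂ c<a
  ... | no b≮c | no c≮a = ⊥-elim (¬Dc (I c (≮⇒≥ c≮a) (≮⇒≥ b≮c)))

  no-InD⇒equal : f 0 m₁ ≡ f 0 m₂ → ¬ (∃ λ l → l < suc n × D l) → ∀ l → l ≤ n → f l m₁ ≡ f l m₂
  no-InD⇒equal eq₀ _ zero _ = eq₀
  no-InD⇒equal _ none (suc l) 1+l≤n =
    decidable-stable (f (suc l) m₁ ≟ f (suc l) m₂) (λ ≢ → none (suc l , s≤s 1+l≤n , s≤s z≤n , 1+l≤n , ≢))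

Mirrored : ℕ → ℕ → (ℕ → ℕ → ℕ) → ℕ → ℕ → Set
Mirrored n w f m s = ∀ l → l ≤ n → f l s + f (n ∸ l) m ≡ w

Mirrored-sym : ∀ {n w} f {m s} → Mirrored n w f m s → Mirrored n w f s m
Mirrored-sym {n} {w} f {m} {s} mirrored l l≤n = begin
  f l m + f (n ∸ l) s           ≡⟨ +-comm (f l m) _ ⟩
  f (n ∸ l) s + f l m           ≡⟨ cong (λ k → f (n ∸ l) s + f k m) (sym (m∸[m∸n]≡n l≤n)) ⟩
  f (n ∸ l) s + f (n ∸ (n ∸ l)) m ≡⟨ mirrored (n ∸ l) (m∸n≤m n l) ⟩
  w                             ∎
  where open ≡-Reasoning

Mirrored-level : ∀ {n w w̄} f {m s} → Mirrored n w f m s → f 0 s ≡ 0 → f n m ≡ w̄ → w ≡ w̄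
Mirrored-level f mirrored f[0]≡0 f[n]≡w̄ = trans (sym (mirrored 0 z≤n)) (cong₂ _+_ f[0]≡0 f[n]≡w̄)

1+[n∸a]≡n∸[a∸1] : ∀ {n a} → 1 ≤ a → a ≤ n → suc (n ∸ a) ≡ n ∸ (a ∸ 1)
1+[n∸a]≡n∸[a∸1] {a = suc a} _ a≤n = sym (+-∸-assoc 1 a≤n)

module Mirror (n w̄ : ℕ) (f : ℕ → ℕ → ℕ) (m s : ℕ) (mirrored : Mirrored n w̄ f m s)
              (f[0]≡0 : f 0 m ≡ 0) (f[n]≡w̄ : f n m ≡ w̄) where

  open MaxIntervals n f m s
  open Halves n

  Balanced : ℕ → Set
  Balanced l = f l m + f (n ∸ l) m ≡ w̄

  balanced⇒equal : ∀ {l} → l ≤ n → Balanced l → f l m ≡ f l s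
  balanced⇒equal {l} l≤n bal = +-cancelʳ-≡ (f (n ∸ l) m) _ _ (trans bal (sym (mirrored l l≤n)))

  equal⇒balanced : ∀ {l} → l ≤ n → f l m ≡ f l s → Balanced l
  equal⇒balanced {l} l≤n eq = trans (cong (_+ f (n ∸ l) m) eq) (mirrored l l≤n)

  Balanced-mirror : ∀ {l} → l ≤ n → Balanced l → Balanced (n ∸ l)
  Balanced-mirror {l} l≤n bal =
    trans (cong (λ k → f (n ∸ l) m + f k m) (m∸[m∸n]≡n l≤n)) (trans (+-comm (f (n ∸ l) m) _) bal)

  Balanced-0 : Balanced 0
  Balanced-0 = cong₂ _+_ f[0]≡0 f[n]≡w̄

  ¬InD-n : ¬ D n
  ¬InD-n (_ , _ , ≢) = ≢ (balanced⇒equal ≤-refl (Balanced-mirror z≤n Balanced-0))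

  InD-mirror : ∀ {l} → D l → D (n ∸ l)
  InD-mirror {l} Dl@(_ , l≤n , ≢) = m<n⇒0<n∸m l<n , m∸n≤m n l , λ eq →
    ≢ (balanced⇒equal l≤n (subst Balanced (m∸[m∸n]≡n l≤n)
        (Balanced-mirror (m∸n≤m n l) (equal⇒balanced (m∸n≤m n l) eq))))
    where
    l<n : l < n
    l<n = ≤∧≢⇒< l≤n λ { refl → ¬InD-n Dl }

  InD-reflect : ∀ {l} → D (n ∸ l) → D l
  InD-reflect {l} Dn∸l = subst D (m∸[m∸n]≡n (<⇒≤ l<n)) (InD-mirror Dn∸l)
    where
    l<n : l < n
    l<n = m∸n≢0⇒n<m (λ n∸l≡0 → ¬InD-0 (subst D n∸l≡0 Dn∸l))

  MaxInterval-mirror : ∀ {a b} → MI a b → MI (n ∸ b) (n ∸ a)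
  MaxInterval-mirror {a} {b} (a≤b , 1≤a , b≤n , I , ¬Dˡ , ¬Dʳ) =
    ∸-monoʳ-≤ n a≤b , proj₁ (InD-mirror (I b a≤b ≤-refl)) , m∸n≤m n a , I′ , ¬Dˡ′ , ¬Dʳ′
    where
    a≤n : a ≤ n
    a≤n = ≤-trans a≤b b≤n
    I′ : IntervalInD (n ∸ b) (n ∸ a)
    I′ l n∸b≤l l≤n∸a = InD-reflect (I (n ∸ l)
      (subst (_≤ n ∸ l) (m∸[m∸n]≡n a≤n) (∸-monoʳ-≤ n l≤n∸a))
      (subst (n ∸ l ≤_) (m∸[m∸n]≡n b≤n) (∸-monoʳ-≤ n n∸b≤l)))
    ¬Dˡ′ : ¬ D (n ∸ b ∸ 1)
    ¬Dˡ′ D′ = ¬Dʳ (InD-reflect (subst D (trans (∸-+-assoc n b 1) (cong (n ∸_) (+-comm b 1))) D′))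
    ¬Dʳ′ : ¬ D (suc (n ∸ a))
    ¬Dʳ′ D′ = ¬Dˡ (InD-reflect (subst D (1+[n∸a]≡n∸[a∸1] 1≤a a≤n) D′))

  InA-half⇒Balanced : InA-half n f w̄ m → Balanced p
  InA-half⇒Balanced = subst (λ k → f p m + f k m ≡ w̄) (sym n∸p≡q)

  Balanced⇒InA-half : Balanced p → InA-half n f w̄ m
  Balanced⇒InA-half = subst (λ k → f p m + f k m ≡ w̄) n∸p≡q

  MaxInterval-symmetric⇒∋p : ∀ {a b} → MI a b → a ≡ n ∸ b → a ≤ p × p ≤ b
  MaxInterval-symmetric⇒∋p (a≤b , _ , b≤n , _) = symmetric⇒∋p a≤b b≤n

  InA-half⇒coincide⊎exactlyTwo : AtMostTwoMI n f m s → InA-half n f w̄ m →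
    (∀ l → l ≤ n → f l m ≡ f l s) ⊎ ExactlyTwoMIOneInLowerHalf n f m s
  InA-half⇒coincide⊎exactlyTwo atMostTwo inA with anyUpTo? InD? (suc n)
  ... | no none = inj₁ (no-InD⇒equal (trans f[0]≡0 (sym f[0]≡0′)) none)
    where
    f[0]≡0′ : f 0 s ≡ 0
    f[0]≡0′ = +-cancelʳ-≡ (f n m) _ 0 (trans (mirrored 0 z≤n) (sym f[n]≡w̄))
  ... | yes (l , _ , Dl) with MaxInterval-extend ≤-refl (IntervalInD-pair (n≤1+n l) Dl Dl)
  ...   | a , b , I , _ = inj₂ (a , b , n ∸ b , n ∸ a , I , I* , I≢I* , onlyTwo , oneInLowerHalf)
    where
    ¬Dp : ¬ D p
    ¬Dp (_ , p≤n , ≢) = ≢ (balanced⇒equal p≤n (InA-half⇒Balanced inA))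
    I* : MI (n ∸ b) (n ∸ a)
    I* = MaxInterval-mirror I
    a≤b : a ≤ b
    a≤b = proj₁ I
    I≢I* : ¬ (a ≡ n ∸ b × b ≡ n ∸ a)
    I≢I* (a≡n∸b , _) with MaxInterval-symmetric⇒∋p I a≡n∸b
    ... | a≤p , p≤b = ¬Dp (proj₁ (proj₂ (proj₂ (proj₂ I))) p a≤p p≤b)
    onlyTwo : ∀ x y → MI x y → (x ≡ a × y ≡ b) ⊎ (x ≡ n ∸ b × y ≡ n ∸ a)
    onlyTwo x y J with atMostTwo a b (n ∸ b) (n ∸ a) x y I I* J
    ... | inj₁ I≡I* = ⊥-elim (I≢I* I≡I*)
    ... | inj₂ (inj₁ (refl , refl)) = inj₁ (refl , refl)
    ... | inj₂ (inj₂ (refl , refl)) = inj₂ (refl , refl)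
    oneInLowerHalf : (IntervalSubset a b p × ¬ IntervalSubset (n ∸ b) (n ∸ a) p)
                   ⊎ (¬ IntervalSubset a b p × IntervalSubset (n ∸ b) (n ∸ a) p)
    oneInLowerHalf with MaxInterval-avoid I ¬Dp
    ... | inj₁ b<p = inj₁ (IntervalSubset-intro (proj₁ (proj₂ I)) (<⇒≤ b<p) ,
                           λ sub → <⇒≱ p<n∸a (IntervalSubset⇒≤ (proj₁ I*) sub))
      where
      open ≤-Reasoning
      p<n∸a : p < n ∸ a
      p<n∸a = begin-strict
        p     ≤⟨ p≤q ⟩
        q     ≡⟨ sym n∸p≡q ⟩
        n ∸ p <⟨ ∸-monoʳ-< b<p p≤n ⟩
        n ∸ b ≤⟨ ∸-monoʳ-≤ n a≤b ⟩
        n ∸ a ∎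
    ... | inj₂ p<a = inj₂ ((λ sub → <⇒≱ (<-≤-trans p<a a≤b) (IntervalSubset⇒≤ a≤b sub)) ,
                           IntervalSubset-intro (proj₁ (proj₂ I*)) n∸a≤p)
      where
      open ≤-Reasoning
      n∸a≤p : n ∸ a ≤ p
      n∸a≤p = m≤n+o⇒m∸n≤o n a (begin
        n     ≡⟨ sym p+q≡n ⟩
        p + q ≤⟨ +-monoʳ-≤ p (≤-trans q≤1+p p<a) ⟩
        p + a ≡⟨ +-comm p a ⟩
        a + p ∎)

  ¬InA-half⇒exactlyOne : AtMostTwoMI n f m s → ¬ InA-half n f w̄ m → ExactlyOneMI n f m s
  ¬InA-half⇒exactlyOne atMostTwo ¬inA with MaxInterval-extend p≤q (IntervalInD-pair q≤1+p Dp Dq)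
    where
    unbal : ¬ Balanced p
    unbal = ¬inA ∘ Balanced⇒InA-half
    1≤p : 1 ≤ p
    1≤p = n≢0⇒n>0 λ p≡0 → unbal (subst Balanced (sym p≡0) Balanced-0)
    Dp : D p
    Dp = 1≤p , p≤n , λ eq → unbal (equal⇒balanced p≤n eq)
    Dq : D q
    Dq = subst D n∸p≡q (InD-mirror Dp)
  ... | a₀ , b₀ , I₀ , a₀≤p , q≤b₀ = (a₀ , b₀ , I₀) , λ a b c d I J → ≡I₀⇒≡ (≡I₀ I) (≡I₀ J)
    where
    ∋p⇒≡I₀ : ∀ {x y} → MI x y → x ≤ p → p ≤ y → x ≡ a₀ × y ≡ b₀
    ∋p⇒≡I₀ J x≤p p≤y = MaxInterval-overlap⇒≡ J I₀ (≤-trans a₀≤p p≤y) (≤-trans x≤p (≤-trans p≤q q≤b₀))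
    ≡I₀ : ∀ {x y} → MI x y → x ≡ a₀ × y ≡ b₀
    ≡I₀ {x} {y} J with atMostTwo a₀ b₀ x y (n ∸ y) (n ∸ x) I₀ J (MaxInterval-mirror J)
    ... | inj₁ (refl , refl) = refl , refl
    ... | inj₂ (inj₂ (x≡n∸y , _)) = uncurry (∋p⇒≡I₀ J) (MaxInterval-symmetric⇒∋p J x≡n∸y)
    ... | inj₂ (inj₁ (refl , refl)) = ∋p⇒≡I₀ J x≤p p≤y
      where
      x≤y : x ≤ y
      x≤y = proj₁ J
      y≤n : y ≤ n
      y≤n = proj₁ (proj₂ (proj₂ J))
      x≤p : x ≤ p
      x≤p = ∸-cancelʳ-≤ (≤-trans x≤y y≤n) (subst (_≤ n ∸ x) (sym n∸p≡q) q≤b₀)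
      p≤y : p ≤ y
      p≤y = ∸-cancelʳ-≤ p≤n (subst (n ∸ y ≤_) (sym n∸p≡q) (≤-trans a₀≤p p≤q))
    ≡I₀⇒≡ : ∀ {a b c d} → a ≡ a₀ × b ≡ b₀ → c ≡ a₀ × d ≡ b₀ → a ≡ c × b ≡ d
    ≡I₀⇒≡ (refl , refl) (refl , refl) = refl , refl

wt≤length : ∀ t → wt t ≤ length t
wt≤length [] = z≤n
wt≤length (true ∷ t) = s≤s (wt≤length t)
wt≤length (false ∷ t) = m≤n⇒m≤1+n (wt≤length t)

FullLengthWeight : ℕ → ℕ → ℕ × ℕ → Set
FullLengthWeight n w (a , b) = a + b ≡ n → b ≡ w

pt-fullLengthWeight : ∀ {n w} s j → wt s ≤ j → (j ≡ n → wt s ≡ w) → FullLengthWeight n w (pt s j)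
pt-fullLengthWeight s j wt≤j j≡n⇒ sum≡n = j≡n⇒ (trans (sym (m∸n+n≡m wt≤j)) sum≡n)

Mt-fullLengthWeight : ∀ t → All (FullLengthWeight (length t) (wt t)) (Mt t)
Mt-fullLengthWeight t =
  ++⁺ (map⁺ (All.universal prefix-point (range1 (length t))))
      (map⁺ (All.universal suffix-point (range1 (length t))))
  where
  open ≤-Reasoning
  prefix-point : ∀ j → FullLengthWeight (length t) (wt t) (pt (prefix j t) j)
  prefix-point j = pt-fullLengthWeight (take j t) j
    (begin
      wt (take j t)     ≤⟨ wt≤length (take j t) ⟩
      length (take j t) ≡⟨ length-take j t ⟩
      j ⊓ length t      ≤⟨ m⊓n≤m j _ ⟩
      j                 ∎)
    λ { refl → cong wt (take-all j t ≤-refl) }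
  suffix-point : ∀ j → FullLengthWeight (length t) (wt t) (pt (suffix j t) j)
  suffix-point j = pt-fullLengthWeight (drop (length t ∸ j) t) j
    (begin
      wt (drop (length t ∸ j) t)     ≤⟨ wt≤length (drop (length t ∸ j) t) ⟩
      length (drop (length t ∸ j) t) ≡⟨ length-drop (length t ∸ j) t ⟩
      length t ∸ (length t ∸ j)      ≤⟨ m≤n+o⇒m∸n≤o (length t) (length t ∸ j)
                                          (subst (length t ≤_) (+-comm j _) (m≤n+m∸n (length t) j)) ⟩
      j                              ∎)
    λ { refl → cong (λ k → wt (drop k t)) (n∸n≡0 (length t)) }

MH-fullLengthWeight : ∀ {n w} H → All (λ t → length t ≡ n × wt t ≡ w) H → All (FullLengthWeight n w) (MH H)
MH-fullLengthWeight H all = concat⁺ (map⁺ (All.map (λ { {t} (refl , refl) → Mt-fullLengthWeight t }) all))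

∈-range1 : ∀ {k n} → 1 ≤ k → k ≤ n → k ∈ range1 n
∈-range1 {suc k} _ k<n = ∈-map⁺ suc (∈-upTo⁺ k<n)

solution⇒f[n]≡w : ∀ {n w} H h f → All (λ t → length t ≡ n × wt t ≡ w) H → IsSolution n h f (MH H) →
  1 ≤ n → ∀ {m} → 1 ≤ m → m ≤ 2 * h → f n m ≤ n → f n m ≡ w
solution⇒f[n]≡w {n} {w} H h f all sol 1≤n {m} 1≤m m≤2h f[n]≤n =
  All.lookup (MH-fullLengthWeight H all) (∈-resp-↭ (↭-sym sol) ∈solList) (m∸n+n≡m f[n]≤n)
  where
  ∈solList : (n ∸ f n m , f n m) ∈ solList n h f
  ∈solList = ∈-concatMap⁺ (λ m′ → map (λ l → (l ∸ f l m′ , f l m′)) (range1 n))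
    (lose (∈-range1 1≤m m≤2h) (∈-map⁺ (λ l → (l ∸ f l m , f l m)) (∈-range1 1≤n ≤-refl)))

star-odd : ∀ k → star (suc (k * 2)) ≡ suc k * 2
star-odd k with suc (k * 2) % 2 | [m+kn]%n≡m%n 1 k 2
... | .1 | refl = refl

star-even : ∀ k → star (suc k * 2) ≡ suc (k * 2)
star-even k with suc k * 2 % 2 | m*n%n≡0 (suc k) 2
... | .0 | refl = refl

odd-or-even : ∀ m → 1 ≤ m → ∃ λ k → m ≡ suc (k * 2) ⊎ m ≡ suc k * 2
odd-or-even (suc zero) _ = zero , inj₁ refl
odd-or-even (suc (suc zero)) _ = zero , inj₂ refl
odd-or-even (suc (suc (suc m))) _ with odd-or-even (suc m) (s≤s z≤n)
... | k , inj₁ eq = suc k , inj₁ (cong (2 +_) eq)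
... | k , inj₂ eq = suc k , inj₂ (cong (2 +_) eq)

j≤h⇒j*2≤2*h : ∀ {j h} → j ≤ h → j * 2 ≤ 2 * h
j≤h⇒j*2≤2*h {j} {h} j≤h = subst (j * 2 ≤_) (*-comm h 2) (*-monoˡ-≤ 2 j≤h)

CWF-pair : ∀ {n h w̄ f} → CWF n h f → (∀ m → 1 ≤ m → m ≤ 2 * h → f n m ≡ w̄) →
  ∀ k → suc k ≤ h → Mirrored n w̄ f (suc k * 2) (suc (k * 2))
CWF-pair {n} {h} {w̄} {f} (_ , f[0]≡0 , _ , level) f[n]≡w̄ k 1+k≤h
  with level (suc k) (s≤s z≤n) 1+k≤h
... | w , mirrored′ = subst (λ w → Mirrored n w f (suc k * 2) (suc (k * 2))) w≡w̄ mirrored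
  where
  2j≡j*2 : 2 * suc k ≡ suc k * 2
  2j≡j*2 = *-comm 2 (suc k)
  mirrored : Mirrored n w f (suc k * 2) (suc (k * 2))
  mirrored = subst₂ (Mirrored n w f) 2j≡j*2 (cong (_∸ 1) 2j≡j*2) mirrored′
  j*2≤2h : suc k * 2 ≤ 2 * h
  j*2≤2h = j≤h⇒j*2≤2*h 1+k≤h
  w≡w̄ : w ≡ w̄
  w≡w̄ = Mirrored-level f mirrored (f[0]≡0 _ (s≤s z≤n) (≤-trans (n≤1+n _) j*2≤2h))
                                  (f[n]≡w̄ _ (s≤s z≤n) j*2≤2h)

star-mirrored : ∀ {n h w̄ f} → CWF n h f → (∀ m → 1 ≤ m → m ≤ 2 * h → f n m ≡ w̄) →
  ∀ m → 1 ≤ m → m ≤ 2 * h → 1 ≤ star m × star m ≤ 2 * h × Mirrored n w̄ f m (star m)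
star-mirrored {h = h} {f = f} cwf f[n]≡w̄ m 1≤m m≤2h with odd-or-even m 1≤m
... | k , inj₁ refl rewrite star-odd k =
  s≤s z≤n , j≤h⇒j*2≤2*h 1+k≤h , Mirrored-sym f (CWF-pair cwf f[n]≡w̄ k 1+k≤h)
  where
  1+k≤h : suc k ≤ h
  1+k≤h = *-cancelʳ-< 2 k h (subst (suc (k * 2) ≤_) (*-comm 2 h) m≤2h)
... | k , inj₂ refl rewrite star-even k =
  s≤s z≤n , ≤-trans (n≤1+n _) m≤2h , CWF-pair cwf f[n]≡w̄ k 1+k≤h
  where
  1+k≤h : suc k ≤ h
  1+k≤h = *-cancelʳ-≤ (suc k) h 2 (subst (suc k * 2 ≤_) (*-comm 2 h) m≤2h)

proposition5 : (n h w̄ : ℕ) → 1 ≤ n → 1 ≤ h → w̄ ≤ n →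
    (H : List (List Bool)) → length H ≡ h →
    All (λ t → length t ≡ n × wt t ≡ w̄) H →
    (f : ℕ → ℕ → ℕ) → CWF n h f → IsSolution n h f (MH H) →
    (∀ m₁ m₂ → 1 ≤ m₁ → m₁ ≤ 2 * h → 1 ≤ m₂ → m₂ ≤ 2 * h →
       star m₁ ≡ m₂ → AtMostTwoMI n f m₁ m₂) →
    (∀ m₁ m₂ → 1 ≤ m₁ → m₁ ≤ 2 * h → 1 ≤ m₂ → m₂ ≤ 2 * h →
       ¬ (star m₁ ≡ m₂) → AtMostOneMI n f m₁ m₂) →
    (∀ m → 1 ≤ m → m ≤ 2 * h → InA-half n f w̄ m →
       (∀ l → l ≤ n → f l m ≡ f l (star m))
       ⊎ ExactlyTwoMIOneInLowerHalf n f m (star m))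
    × (∀ m → 1 ≤ m → m ≤ 2 * h → ¬ InA-half n f w̄ m →
       ExactlyOneMI n f m (star m))
-- Only (C1) for the pairs (m , m*) is used.
proposition5 n h w̄ 1≤n _ _ H _ all f cwf sol C1 _ =
  (λ m 1≤m m≤2h → let open Pair m 1≤m m≤2h in InA-half⇒coincide⊎exactlyTwo C1-pair) ,
  (λ m 1≤m m≤2h → let open Pair m 1≤m m≤2h in ¬InA-half⇒exactlyOne C1-pair)
  where
  f[n]≡w̄ : ∀ m → 1 ≤ m → m ≤ 2 * h → f n m ≡ w̄
  f[n]≡w̄ m 1≤m m≤2h = solution⇒f[n]≡w H h f all sol 1≤n 1≤m m≤2h (proj₁ cwf n m ≤-refl 1≤m m≤2h)

  module Pair (m : ℕ) (1≤m : 1 ≤ m) (m≤2h : m ≤ 2 * h) where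
    partner : 1 ≤ star m × star m ≤ 2 * h × Mirrored n w̄ f m (star m)
    partner = star-mirrored cwf f[n]≡w̄ m 1≤m m≤2h
    open Mirror n w̄ f m (star m) (proj₂ (proj₂ partner)) (proj₁ (proj₂ cwf) m 1≤m m≤2h)
                (f[n]≡w̄ m 1≤m m≤2h) public
    C1-pair : AtMostTwoMI n f m (star m)
    C1-pair = C1 m (star m) 1≤m m≤2h (proj₁ partner) (proj₁ (proj₂ partner)) refl
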